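{- Let $G$ be a finite simple graph on $n$ vertices and let $k=\lceil n/2\rceil$. If \[ \sigma_k(G)-\tau_k(G)\le\frac{2k+1-n}{k+1}, \] then $D(G,x)$ is unimodal with mode $k$, i.e. $d_0(G)\le\cdots\le d_k(G)\ge d_{k+1}(G)\ge\cdots\ge d_n(G)$.
   Context: A set $S\subseteq V(G)$ is dominating if every vertex of $G$ is in $S$ or adjacent to a vertex of $S$; $d_j(G)$ is the number of dominating sets of size $j$ and $D(G,x)=\sum_{j=0}^n d_j(G)x^j$. $N[v]$ is the closed neighborhood of $v$. Binomial coefficients $\binom{a}{k}$ are $0$ when $k>a$. Define $\sigma_k(G)=\sum_{v\in V(G)}\binom{n-|N[v]|}{k}\big/\binom{n}{k}$ and \[ \tau_k(G)=\max_T\sum_{uv\in E(T)}\frac{\binom{n-|N[u]\cup N[v]|}{k}}{\binom{n}{k}}, \] where the maximum ranges over all spanning trees $T$ of the complete graph on the vertex set $V(G)$ (edges of $T$ need not be edges of $G$). -}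

module Defs where

open import Data.Bool using (Bool; true; false; _∨_; _∧_; if_then_else_)
open import Data.Nat using (ℕ; zero; suc; _∸_)
open import Data.Nat.Combinatorics using (_C_)
open import Data.Fin using (Fin)
open import Data.Fin.Properties using (_≟_; all?; any?)
open import Data.Fin.Subset using (Subset; _∈_; _∪_; ∣_∣)
open import Data.Fin.Subset.Properties using (_∈?_)
open import Data.Vec using (Vec; []; _∷_; tabulate)
open import Data.List using (List; []; _∷_; _++_; [_]; map; filter; length; foldr; concatMap; allFin)
open import Data.List.Relation.Unary.Unique.Propositional using (Unique)
open import Data.List.Relation.Unary.Linked using (Linked)
open import Data.Product using (Σ; ∃; _×_; _,_)
open import Data.Sum using (_⊎_)
open import Data.Integer using (+_)
open import Data.Rational using (ℚ; 0ℚ; _/_; _+_)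
open import Relation.Binary.PropositionalEquality using (_≡_)
open import Relation.Nullary using (Dec; yes; no; ¬_)
open import Relation.Nullary.Decidable using (isYes; _⊎-dec_; _×-dec_)

record Graph (n : ℕ) : Set where
  field
    adj    : Fin n → Fin n → Bool
    sym    : ∀ u v → adj u v ≡ adj v u
    irrefl : ∀ v → adj v v ≡ false
open Graph public

Adj : ∀ {n} → Graph n → Fin n → Fin n → Set
Adj G u v = adj G u v ≡ true

N[_] : ∀ {n} {G : Graph n} → Fin n → Subset n
N[_] {G = G} v = tabulate (λ u → isYes (u ≟ v) ∨ adj G v u)

closedNbhd : ∀ {n} → Graph n → Fin n → Subset n
closedNbhd G v = N[_] {G = G} v

Dominating : ∀ {n} → Graph n → Subset n → Set
Dominating {n} G S = ∀ (v : Fin n) → v ∈ S ⊎ (∃ λ u → u ∈ S × Adj G u v)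

Dominating? : ∀ {n} (G : Graph n) (S : Subset n) → Dec (Dominating G S)
Dominating? G S = all? λ v → (v ∈? S) ⊎-dec any? (λ u → (u ∈? S) ×-dec (adj G u v Data.Bool.≟ true))
  where import Data.Bool

allSubsets : (n : ℕ) → List (Subset n)
allSubsets zero    = [] ∷ []
allSubsets (suc n) = concatMap (λ S → (true ∷ S) ∷ (false ∷ S) ∷ []) (allSubsets n)

d : ∀ {n} → Graph n → ℕ → ℕ
d {n} G j = length (filter (λ S → Dominating? G S ×-dec (∣ S ∣ Data.Nat.≟ j)) (allSubsets n))
  where import Data.Nat

-- a / b as a rational; only ever used with b = C(n,k) ≥ 1 or b = k+1 ≥ 1
frac : ℕ → ℕ → ℚ
frac a zero    = 0ℚ
frac a (suc b) = (+ a) / suc b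

Σℚ : ∀ {A : Set} → List A → (A → ℚ) → ℚ
Σℚ xs f = foldr (λ x acc → f x + acc) 0ℚ xs

σ : ∀ {n} → ℕ → Graph n → ℚ
σ {n} k G = Σℚ (allFin n) λ v → frac ((n ∸ ∣ closedNbhd G v ∣) C k) (n C k)

-- Spanning trees of the complete graph K_n on Fin n:
-- a graph T on Fin n (any edges allowed) that is connected and acyclic.

data Reach {n} (T : Graph n) : Fin n → Fin n → Set where
  here : ∀ {v} → Reach T v v
  step : ∀ {u w v} → Adj T u w → Reach T w v → Reach T u v

Connected : ∀ {n} → Graph n → Set
Connected {n} T = ∀ (u v : Fin n) → Reach T u v

-- a cycle x, y₁, …, y_m, y with m ≥ 1 (so length ≥ 3), all vertices distinct,
-- consecutive vertices adjacent and y adjacent to x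
HasCycle : ∀ {n} → Graph n → Set
HasCycle {n} T =
  Σ (Fin n) λ x → Σ (Fin n) λ y → Σ (List (Fin n)) λ ys →
    (1 Data.Nat.≤ length ys) × Unique (x ∷ ys ++ [ y ]) ×
    Linked (Adj T) (x ∷ ys ++ [ y ]) × Adj T y x
  where import Data.Nat

IsSpanningTree : ∀ {n} → Graph n → Set
IsSpanningTree T = Connected T × ¬ HasCycle T

treeWeight : ∀ {n} → ℕ → Graph n → Graph n → ℚ
treeWeight {n} k G T =
  Σℚ (allFin n) λ u → Σℚ (allFin n) λ v →
    if isYes (u Data.Fin.<? v) ∧ adj T u v
    then frac ((n ∸ ∣ closedNbhd G u ∪ closedNbhd G v ∣) C k) (n C k)
    else 0ℚ
  where import Data.Fin

IsTau : ∀ {n} → ℕ → Graph n → ℚ → Set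
IsTau {n} k G t =
  (Σ (Graph n) λ T → IsSpanningTree T × treeWeight k G T ≡ t) ×
  (∀ (T : Graph n) → IsSpanningTree T → treeWeight k G T Data.Rational.≤ t)
  where import Data.Rational

UnimodalWithMode : ∀ {n} → Graph n → ℕ → Set
UnimodalWithMode {n} G k =
  (∀ i → i Data.Nat.< k → d G i Data.Nat.≤ d G (suc i)) ×
  (∀ i → k Data.Nat.≤ i → i Data.Nat.< n → d G (suc i) Data.Nat.≤ d G i)
  where import Data.Nat

{-# OPTIONS --safe #-}
module Submission where

-- Let S range over the k-subsets of the vertices and let U_S be the set of vertices that S
-- does not dominate: v ∈ U_S iff S avoids N[v], and u, v ∈ U_S iff S avoids N[u] ∪ N[v].
-- The edges of a spanning tree T inside U_S form a forest, and U_S ≠ ∅ iff S is not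
-- dominating, so
--   [S is not dominating] + e_T(U_S) ≤ |U_S|.
-- Summing over S gives C(n,k) − d_k ≤ C(n,k)(σ_k − w_T) for the weight w_T of T. As
-- (2k+1−n)/(k+1) = 1 − C(n,k+1)/C(n,k), the hypothesis, applied to a tree of weight τ_k,
-- yields d_k ≥ C(n,k+1). Dominating sets form an up-set, so the local LYM inequality
-- d_j (n−j) ≤ d_{j+1} (j+1) holds: below k = ⌈n/2⌉ it gives d_j ≤ d_{j+1}, and from k on it
-- propagates d_j ≥ C(n,j+1), whence d_{j+1} ≤ C(n,j+1) ≤ d_j.

module Sums where

  open import Data.Bool using (Bool; true; false; if_then_else_)
  open import Data.Empty using (⊥-elim)
  open import Data.Fin using (Fin; zero; suc)
  open import Data.Fin.Properties using (_≟_; _<?_)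
  import Data.Fin.Properties as Finₚ
  open import Data.Nat hiding (_≟_; _<?_)
  open import Data.Nat.Properties hiding (_≟_; _<?_)
  open import Algebra.Properties.CommutativeMonoid.Sum +-0-commutativeMonoid
    using (sum; sum-syntax; sum-cong-≗; sum-replicate-zero; ∑-distrib-+; ∑-comm)
  open import Function using (_∘_)
  open import Relation.Binary.Definitions using (tri<; tri≈; tri>)
  open import Relation.Binary.PropositionalEquality
  open import Relation.Nullary using (¬_; yes; no; does)
  open import Relation.Nullary.Decidable using (isYes; dec-true; dec-false)

  𝟙 : Bool → ℕ
  𝟙 b = if b then 1 else 0

  sum-mono-≤ : ∀ {n} {f g : Fin n → ℕ} → (∀ i → f i ≤ g i) → sum f ≤ sum g
  sum-mono-≤ {zero}  f≤g = z≤n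
  sum-mono-≤ {suc n} f≤g = +-mono-≤ (f≤g zero) (sum-mono-≤ (f≤g ∘ suc))

  sum-zero : ∀ {n} {f : Fin n → ℕ} → (∀ i → f i ≡ 0) → sum f ≡ 0
  sum-zero {n} f≗0 = trans (sum-cong-≗ f≗0) (sum-replicate-zero n)

  sum-single : ∀ {n} (f : Fin n → ℕ) v → (∀ i → ¬ i ≡ v → f i ≡ 0) → sum f ≡ f v
  sum-single f zero    f≡0 = trans (cong (f zero +_) (sum-zero λ i → f≡0 (suc i) λ ())) (+-identityʳ _)
  sum-single f (suc v) f≡0 =
    cong₂ _+_ (f≡0 zero λ ()) (sum-single (f ∘ suc) v λ i i≢v → f≡0 (suc i) λ { refl → i≢v refl })

  sum-if : ∀ {n} b (f : Fin n → ℕ) → (if b then sum f else 0) ≡ sum (λ i → if b then f i else 0)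
  sum-if     true  f = refl
  sum-if {n} false f = sym (sum-zero {n} λ _ → refl)

  sum-split : ∀ {n} (f : Fin n → ℕ) v → sum f ≡ f v + sum (λ x → if does (x ≟ v) then 0 else f x)
  sum-split {n} f v = begin
    sum f
      ≡⟨ sum-cong-≗ split ⟩
    sum (λ x → (if does (x ≟ v) then f v else 0) + rest x)
      ≡⟨ ∑-distrib-+ {n} (λ x → if does (x ≟ v) then f v else 0) rest ⟩
    sum (λ x → if does (x ≟ v) then f v else 0) + sum rest
      ≡⟨ cong (_+ sum rest) (sum-single _ v off-v) ⟩
    (if does (v ≟ v) then f v else 0) + sum rest
      ≡⟨ cong (λ b → (if b then f v else 0) + sum rest) (dec-true (v ≟ v) refl) ⟩
    f v + sum rest
      ∎
    where
    open ≡-Reasoning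
    rest : Fin n → ℕ
    rest x = if does (x ≟ v) then 0 else f x
    split : ∀ x → f x ≡ (if does (x ≟ v) then f v else 0) + rest x
    split x with x ≟ v
    ... | yes refl = sym (+-identityʳ (f x))
    ... | no  _    = refl
    off-v : ∀ x → ¬ x ≡ v → (if does (x ≟ v) then f v else 0) ≡ 0
    off-v x x≢v = cong (if_then f v else 0) (dec-false (x ≟ v) x≢v)

  ∑∑-symmetric : ∀ {n} (g : Fin n → Fin n → ℕ) → (∀ u w → g u w ≡ g w u) → (∀ u → g u u ≡ 0) →
                 ∑[ u < n ] ∑[ w < n ] g u w ≡ 2 * ∑[ u < n ] ∑[ w < n ] (if isYes (u <? w) then g u w else 0)
  ∑∑-symmetric {n} g g-sym g-diag = begin
    ∑[ u < n ] ∑[ w < n ] g u w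
      ≡⟨ sum-cong-≗ (λ u → sum-cong-≗ (split u)) ⟩
    ∑[ u < n ] ∑[ w < n ] (below u w + below w u)
      ≡⟨ sum-cong-≗ (λ u → ∑-distrib-+ {n} (below u) (λ w → below w u)) ⟩
    ∑[ u < n ] (∑[ w < n ] below u w + ∑[ w < n ] below w u)
      ≡⟨ ∑-distrib-+ {n} (λ u → ∑[ w < n ] below u w) _ ⟩
    L + ∑[ u < n ] ∑[ w < n ] below w u
      ≡⟨ cong (L +_) (∑-comm {n} {n} (λ u w → below w u)) ⟩
    L + L
      ≡⟨ cong (L +_) (+-identityʳ L) ⟨
    2 * L
      ∎
    where
    open ≡-Reasoning
    below : Fin n → Fin n → ℕ
    below u w = if isYes (u <? w) then g u w else 0
    L = ∑[ u < n ] ∑[ w < n ] below u w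
    split : ∀ u w → g u w ≡ below u w + below w u
    split u w with u <? w | w <? u
    ... | yes u<w | yes w<u = ⊥-elim (Finₚ.<-asym u<w w<u)
    ... | yes _   | no  _   = sym (+-identityʳ (g u w))
    ... | no  _   | yes _   = g-sym u w
    ... | no  u≮w | no  w≮u with Finₚ.<-cmp u w
    ...   | tri< u<w _    _   = ⊥-elim (u≮w u<w)
    ...   | tri> _   _    w<u = ⊥-elim (w≮u w<u)
    ...   | tri≈ _   refl _   = g-diag u

  module _ {n : ℕ} where

    sumOver : (Fin n → Bool) → (Fin n → ℕ) → ℕ
    sumOver U f = sum (λ x → if U x then f x else 0)

    size : (Fin n → Bool) → ℕ
    size U = sumOver U (λ _ → 1)

    _─_ : (Fin n → Bool) → Fin n → Fin n → Bool
    (U ─ v) x = if does (x ≟ v) then false else U x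

    sumOver-cong : ∀ U {f g : Fin n → ℕ} → (∀ x → f x ≡ g x) → sumOver U f ≡ sumOver U g
    sumOver-cong U f≗g = sum-cong-≗ λ x → cong (if U x then_else 0) (f≗g x)

    sumOver-mono-≤ : ∀ U {f g : Fin n → ℕ} → (∀ x → f x ≤ g x) → sumOver U f ≤ sumOver U g
    sumOver-mono-≤ U f≤g = sum-mono-≤ λ x → if-mono (U x) (f≤g x)
      where
      if-mono : ∀ b {a c} → a ≤ c → (if b then a else 0) ≤ (if b then c else 0)
      if-mono true  a≤c = a≤c
      if-mono false _   = z≤n

    sumOver-distrib-+ : ∀ U (f g : Fin n → ℕ) → sumOver U (λ x → f x + g x) ≡ sumOver U f + sumOver U g
    sumOver-distrib-+ U f g =
      trans (sum-cong-≗ λ x → if-+ (U x)) (∑-distrib-+ {n} (λ x → if U x then f x else 0) _)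
      where
      if-+ : ∀ b {a c} → (if b then a + c else 0) ≡ (if b then a else 0) + (if b then c else 0)
      if-+ true  = refl
      if-+ false = refl

    sumOver-remove : ∀ U v f → U v ≡ true → sumOver U f ≡ f v + sumOver (U ─ v) f
    sumOver-remove U v f Uv = begin
      sumOver U f
        ≡⟨ sum-split _ v ⟩
      (if U v then f v else 0) + sum (λ x → if does (x ≟ v) then 0 else _)
        ≡⟨ cong₂ _+_ (cong (if_then f v else 0) Uv) (sum-cong-≗ if-─) ⟩
      f v + sumOver (U ─ v) f
        ∎
      where
      open ≡-Reasoning
      if-─ : ∀ x → (if does (x ≟ v) then 0 else (if U x then f x else 0)) ≡ (if (U ─ v) x then f x else 0)
      if-─ x with x ≟ v
      ... | yes _ = refl
      ... | no  _ = refl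

    size-remove : ∀ U v → U v ≡ true → size U ≡ suc (size (U ─ v))
    size-remove U v = sumOver-remove U v (λ _ → 1)

module SubsetSums where

  open import Data.Bool using (Bool; true; false; _∧_; not; if_then_else_)
  open import Data.Bool.Properties using (∧-zeroʳ)
  open import Data.Fin using (Fin; zero; suc)
  open import Data.Fin.Subset using (Subset; ∣_∣; _⊆_; _∈_; _∪_)
  open import Data.Fin.Subset.Properties using (∣p∣≤n)
  open import Data.Nat
  open import Data.Nat.Combinatorics using (_C_; nCk+nC[k+1]≡[n+1]C[k+1])
  open import Data.Nat.Properties
  open import Algebra.Properties.CommutativeMonoid.Sum +-0-commutativeMonoid using (sum-syntax; ∑-distrib-+)
  open import Algebra.Properties.CommutativeSemigroup +-commutativeSemigroup using (interchange)
  open import Data.Nat.Tactic.RingSolver using (solve-∀)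
  open import Data.List using (List; []; _∷_; filter; length; concatMap)
  open import Data.List.Properties using (filter-≐; filter-none)
  import Data.List.Relation.Unary.All as All
  open import Data.Product using (_×_; _,_)
  open import Data.Vec using ([]; _∷_; here; there; tabulate)
  open import Function using (_∘_)
  open import Relation.Binary.PropositionalEquality
  open import Relation.Nullary using (yes; no; does)
  open import Relation.Nullary.Decidable using (_×-dec_)
  open import Relation.Unary using (Decidable)
  open import Defs using (allSubsets)
  open Sums using (𝟙; sum-zero)

  subsetSum : ∀ n → ℕ → (Subset n → ℕ) → ℕ
  subsetSum zero    zero    f = f []
  subsetSum zero    (suc k) f = 0
  subsetSum (suc n) zero    f = subsetSum n zero (f ∘ (false ∷_))
  subsetSum (suc n) (suc k) f = subsetSum n k (f ∘ (true ∷_)) + subsetSum n (suc k) (f ∘ (false ∷_))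

  subsetSum-cong : ∀ n k {f g : Subset n → ℕ} → (∀ S → f S ≡ g S) → subsetSum n k f ≡ subsetSum n k g
  subsetSum-cong zero    zero    f≗g = f≗g []
  subsetSum-cong zero    (suc k) f≗g = refl
  subsetSum-cong (suc n) zero    f≗g = subsetSum-cong n zero (f≗g ∘ (false ∷_))
  subsetSum-cong (suc n) (suc k) f≗g =
    cong₂ _+_ (subsetSum-cong n k (f≗g ∘ (true ∷_))) (subsetSum-cong n (suc k) (f≗g ∘ (false ∷_)))

  subsetSum-mono-≤ : ∀ n k {f g : Subset n → ℕ} → (∀ S → f S ≤ g S) → subsetSum n k f ≤ subsetSum n k g
  subsetSum-mono-≤ zero    zero    f≤g = f≤g []
  subsetSum-mono-≤ zero    (suc k) f≤g = z≤n
  subsetSum-mono-≤ (suc n) zero    f≤g = subsetSum-mono-≤ n zero (f≤g ∘ (false ∷_))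
  subsetSum-mono-≤ (suc n) (suc k) f≤g =
    +-mono-≤ (subsetSum-mono-≤ n k (f≤g ∘ (true ∷_))) (subsetSum-mono-≤ n (suc k) (f≤g ∘ (false ∷_)))

  subsetSum-zero : ∀ n k {f : Subset n → ℕ} → (∀ S → f S ≡ 0) → subsetSum n k f ≡ 0
  subsetSum-zero zero    zero    f≗0 = f≗0 []
  subsetSum-zero zero    (suc k) f≗0 = refl
  subsetSum-zero (suc n) zero    f≗0 = subsetSum-zero n zero (f≗0 ∘ (false ∷_))
  subsetSum-zero (suc n) (suc k) f≗0 =
    cong₂ _+_ (subsetSum-zero n k (f≗0 ∘ (true ∷_))) (subsetSum-zero n (suc k) (f≗0 ∘ (false ∷_)))

  subsetSum-distrib-+ : ∀ n k (f g : Subset n → ℕ) →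
                        subsetSum n k (λ S → f S + g S) ≡ subsetSum n k f + subsetSum n k g
  subsetSum-distrib-+ zero    zero    f g = refl
  subsetSum-distrib-+ zero    (suc k) f g = refl
  subsetSum-distrib-+ (suc n) zero    f g = subsetSum-distrib-+ n zero (f ∘ (false ∷_)) (g ∘ (false ∷_))
  subsetSum-distrib-+ (suc n) (suc k) f g = trans
    (cong₂ _+_ (subsetSum-distrib-+ n k (f ∘ (true ∷_)) (g ∘ (true ∷_)))
               (subsetSum-distrib-+ n (suc k) (f ∘ (false ∷_)) (g ∘ (false ∷_))))
    (interchange (subsetSum n k (f ∘ (true ∷_))) (subsetSum n k (g ∘ (true ∷_))) _ _)

  subsetSum-∑-comm : ∀ n k {m} (f : Subset n → Fin m → ℕ) →
                     subsetSum n k (λ S → ∑[ i < m ] f S i) ≡ ∑[ i < m ] subsetSum n k (λ S → f S i)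
  subsetSum-∑-comm zero    zero        f = refl
  subsetSum-∑-comm zero    (suc k) {m} f = sym (sum-zero {m} λ _ → refl)
  subsetSum-∑-comm (suc n) zero        f = subsetSum-∑-comm n zero (f ∘ (false ∷_))
  subsetSum-∑-comm (suc n) (suc k) {m} f = trans
    (cong₂ _+_ (subsetSum-∑-comm n k (f ∘ (true ∷_))) (subsetSum-∑-comm n (suc k) (f ∘ (false ∷_))))
    (sym (∑-distrib-+ {m} (λ i → subsetSum n k (λ S → f (true ∷ S) i)) _))

  subsetSum-if : ∀ n k b (f : Subset n → ℕ) →
                 subsetSum n k (λ S → if b then f S else 0) ≡ (if b then subsetSum n k f else 0)
  subsetSum-if n k true  f = refl
  subsetSum-if n k false f = subsetSum-zero n k λ _ → refl

  count : ∀ n → ℕ → (Subset n → Bool) → ℕ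
  count n k P = subsetSum n k (𝟙 ∘ P)

  count-true : ∀ n k → count n k (λ _ → true) ≡ n C k
  count-true zero    zero    = refl
  count-true zero    (suc k) = refl
  count-true (suc n) zero    = count-true n zero
  count-true (suc n) (suc k) =
    trans (cong₂ _+_ (count-true n k) (count-true n (suc k))) (nCk+nC[k+1]≡[n+1]C[k+1] n k)

  count-complement : ∀ n k (P : Subset n → Bool) → count n k P + count n k (not ∘ P) ≡ n C k
  count-complement n k P = begin
    count n k P + count n k (not ∘ P)              ≡⟨ subsetSum-distrib-+ n k (𝟙 ∘ P) (𝟙 ∘ not ∘ P) ⟨
    subsetSum n k (λ S → 𝟙 (P S) + 𝟙 (not (P S)))  ≡⟨ subsetSum-cong n k (λ S → 𝟙+𝟙∘not (P S)) ⟩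
    count n k (λ _ → true)                         ≡⟨ count-true n k ⟩
    n C k                                          ∎
    where
    open ≡-Reasoning
    𝟙+𝟙∘not : ∀ b → 𝟙 b + 𝟙 (not b) ≡ 1
    𝟙+𝟙∘not true  = refl
    𝟙+𝟙∘not false = refl

  disjoint : ∀ {n} → Subset n → Subset n → Bool
  disjoint []          []          = true
  disjoint (true ∷ S)  (true ∷ X)  = false
  disjoint (true ∷ S)  (false ∷ X) = disjoint S X
  disjoint (false ∷ S) (_ ∷ X)     = disjoint S X

  disjoint-∪ : ∀ {n} (S X Y : Subset n) → disjoint S (X ∪ Y) ≡ disjoint S X ∧ disjoint S Y
  disjoint-∪ []          []          []          = refl
  disjoint-∪ (true ∷ S)  (true ∷ X)  (_ ∷ Y)     = refl
  disjoint-∪ (true ∷ S)  (false ∷ X) (true ∷ Y)  = sym (∧-zeroʳ (disjoint S X))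
  disjoint-∪ (true ∷ S)  (false ∷ X) (false ∷ Y) = disjoint-∪ S X Y
  disjoint-∪ (false ∷ S) (_ ∷ X)     (_ ∷ Y)     = disjoint-∪ S X Y

  disjoint-tabulate : ∀ {n} (S : Subset n) (f : Fin n → Bool) →
                      (∀ u → u ∈ S → f u ≡ false) → disjoint S (tabulate f) ≡ true
  disjoint-tabulate []          f f≡false = refl
  disjoint-tabulate (true ∷ S)  f f≡false rewrite f≡false zero here =
    disjoint-tabulate S (f ∘ suc) λ u u∈S → f≡false (suc u) (there u∈S)
  disjoint-tabulate (false ∷ S) f f≡false =
    disjoint-tabulate S (f ∘ suc) λ u u∈S → f≡false (suc u) (there u∈S)

  count-disjoint : ∀ n k (X : Subset n) → count n k (λ S → disjoint S X) ≡ (n ∸ ∣ X ∣) C k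
  count-disjoint zero    zero    []          = refl
  count-disjoint zero    (suc k) []          = refl
  count-disjoint (suc n) zero    (_ ∷ X)     = count-disjoint n zero X
  count-disjoint (suc n) (suc k) (true ∷ X)  =
    cong₂ _+_ (subsetSum-zero n k λ _ → refl) (count-disjoint n (suc k) X)
  count-disjoint (suc n) (suc k) (false ∷ X) = begin
    count n k (λ S → disjoint S X) + count n (suc k) (λ S → disjoint S X)
      ≡⟨ cong₂ _+_ (count-disjoint n k X) (count-disjoint n (suc k) X) ⟩
    (n ∸ ∣ X ∣) C k + (n ∸ ∣ X ∣) C suc k
      ≡⟨ nCk+nC[k+1]≡[n+1]C[k+1] (n ∸ ∣ X ∣) k ⟩
    suc (n ∸ ∣ X ∣) C suc k
      ≡⟨ cong (_C suc k) (+-∸-assoc 1 (∣p∣≤n X)) ⟨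
    (suc n ∸ ∣ X ∣) C suc k
      ∎
    where open ≡-Reasoning

  length-filter-doubling : ∀ {m} {Q : Subset (suc m) → Set} (Q? : Decidable Q) (xs : List (Subset m)) →
    length (filter Q? (concatMap (λ S → (true ∷ S) ∷ (false ∷ S) ∷ []) xs)) ≡
    length (filter (Q? ∘ (true ∷_)) xs) + length (filter (Q? ∘ (false ∷_)) xs)
  length-filter-doubling Q? []       = refl
  length-filter-doubling Q? (x ∷ xs) with does (Q? (true ∷ x))
  ... | true  with does (Q? (false ∷ x))
  ...   | true  = cong suc (trans (cong suc (length-filter-doubling Q? xs)) (sym (+-suc _ _)))
  ...   | false = cong suc (length-filter-doubling Q? xs)
  length-filter-doubling Q? (x ∷ xs) | false with does (Q? (false ∷ x))
  ...   | true  = trans (cong suc (length-filter-doubling Q? xs)) (sym (+-suc _ _))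
  ...   | false = length-filter-doubling Q? xs

  length-filter-allSubsets : ∀ n j {P : Subset n → Set} (P? : Decidable P) →
    length (filter (λ S → P? S ×-dec (∣ S ∣ ≟ j)) (allSubsets n)) ≡ count n j (does ∘ P?)
  length-filter-allSubsets zero    zero    P? with P? []
  ... | yes _ = refl
  ... | no  _ = refl
  length-filter-allSubsets zero    (suc j) P? with P? []
  ... | yes _ = refl
  ... | no  _ = refl
  length-filter-allSubsets (suc n) zero    {P} P? =
    trans (length-filter-doubling Q? (allSubsets n))
          (cong₂ _+_ (cong length (filter-none (Q? ∘ (true ∷_)) (All.universal (λ { _ (_ , ()) }) (allSubsets n))))
                     (length-filter-allSubsets n zero (P? ∘ (false ∷_))))
    where
    Q? : Decidable (λ S → P S × ∣ S ∣ ≡ 0)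
    Q? S = P? S ×-dec (∣ S ∣ ≟ 0)
  length-filter-allSubsets (suc n) (suc j) {P} P? =
    trans (length-filter-doubling Q? (allSubsets n))
          (cong₂ _+_ (trans (cong length (filter-≐ (Q? ∘ (true ∷_)) Q₁? (drop-suc , add-suc) (allSubsets n)))
                            (length-filter-allSubsets n j (P? ∘ (true ∷_))))
                     (length-filter-allSubsets n (suc j) (P? ∘ (false ∷_))))
    where
    Q? : Decidable (λ S → P S × ∣ S ∣ ≡ suc j)
    Q? S = P? S ×-dec (∣ S ∣ ≟ suc j)
    Q₁? : Decidable (λ S → P (true ∷ S) × ∣ S ∣ ≡ j)
    Q₁? S = P? (true ∷ S) ×-dec (∣ S ∣ ≟ j)
    drop-suc : ∀ {S} → P (true ∷ S) × suc ∣ S ∣ ≡ suc j → P (true ∷ S) × ∣ S ∣ ≡ j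
    drop-suc (p , e) = p , suc-injective e
    add-suc : ∀ {S} → P (true ∷ S) × ∣ S ∣ ≡ j → P (true ∷ S) × suc ∣ S ∣ ≡ suc j
    add-suc (p , e) = p , cong suc e

  UpClosed : ∀ {n} → (Subset n → Bool) → Set
  UpClosed P = ∀ {S S′} → S ⊆ S′ → P S ≡ true → P S′ ≡ true

  module _ {n} {P : Subset (suc n) → Bool} (P↑ : UpClosed P) where

    upClosed-tail : ∀ b → UpClosed (λ S → P (b ∷ S))
    upClosed-tail b S⊆S′ = P↑ λ { here → here ; (there x∈S) → there (S⊆S′ x∈S) }

    count-tail-false≤true : ∀ j → count n j (λ S → P (false ∷ S)) ≤ count n j (λ S → P (true ∷ S))
    count-tail-false≤true j = subsetSum-mono-≤ n j λ S → 𝟙-mono (P↑ λ { (there x∈S) → there x∈S })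
      where
      𝟙-mono : ∀ {a b} → (a ≡ true → b ≡ true) → 𝟙 a ≤ 𝟙 b
      𝟙-mono {false}         _   = z≤n
      𝟙-mono {true}  {true}  _   = ≤-refl
      𝟙-mono {true}  {false} a⇒b with () ← a⇒b refl

  count-upClosed-LYM : ∀ n j {P : Subset n → Bool} → UpClosed P →
                       count n j P * (n ∸ j) ≤ count n (suc j) P * suc j
  count-upClosed-LYM zero    j       {P} P↑ rewrite 0∸n≡0 j | *-zeroʳ (count zero j P) = z≤n
  count-upClosed-LYM (suc n) zero    {P} P↑ = begin
    c₀ 0 * suc n
      ≡⟨ *-suc (c₀ 0) n ⟩
    c₀ 0 + c₀ 0 * n
      ≤⟨ +-mono-≤ (count-tail-false≤true P↑ 0) (count-upClosed-LYM n 0 (upClosed-tail P↑ false)) ⟩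
    c₁ 0 + c₀ 1 * 1
      ≡⟨ collect (c₁ 0) (c₀ 1) ⟩
    (c₁ 0 + c₀ 1) * 1
      ∎
    where
    open ≤-Reasoning
    c₀ c₁ : ℕ → ℕ
    c₀ j = count n j (λ S → P (false ∷ S))
    c₁ j = count n j (λ S → P (true ∷ S))
    collect : ∀ a b → a + b * 1 ≡ (a + b) * 1
    collect = solve-∀
  count-upClosed-LYM (suc n) (suc j) {P} P↑ = begin
    (c₁ j + c₀ (suc j)) * (n ∸ j)
      ≡⟨ *-distribʳ-+ (n ∸ j) (c₁ j) (c₀ (suc j)) ⟩
    c₁ j * (n ∸ j) + c₀ (suc j) * (n ∸ j)
      ≤⟨ +-mono-≤ (count-upClosed-LYM n j (upClosed-tail P↑ true)) (*-monoʳ-≤ (c₀ (suc j)) (n∸j≤1+n∸[1+j] n j)) ⟩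
    c₁ (suc j) * suc j + c₀ (suc j) * suc (n ∸ suc j)
      ≡⟨ cong (c₁ (suc j) * suc j +_) (*-suc (c₀ (suc j)) (n ∸ suc j)) ⟩
    c₁ (suc j) * suc j + (c₀ (suc j) + c₀ (suc j) * (n ∸ suc j))
      ≤⟨ +-monoʳ-≤ (c₁ (suc j) * suc j) (+-mono-≤ (count-tail-false≤true P↑ (suc j))
                                                  (count-upClosed-LYM n (suc j) (upClosed-tail P↑ false))) ⟩
    c₁ (suc j) * suc j + (c₁ (suc j) + c₀ (suc (suc j)) * suc (suc j))
      ≡⟨ collect (c₁ (suc j)) (c₀ (suc (suc j))) j ⟩
    (c₁ (suc j) + c₀ (suc (suc j))) * suc (suc j)
      ∎
    where
    open ≤-Reasoning
    c₀ c₁ : ℕ → ℕ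
    c₀ j = count n j (λ S → P (false ∷ S))
    c₁ j = count n j (λ S → P (true ∷ S))
    collect : ∀ a b j → a * suc j + (a + b * suc (suc j)) ≡ (a + b) * suc (suc j)
    collect = solve-∀
    n∸j≤1+n∸[1+j] : ∀ n j → n ∸ j ≤ suc (n ∸ suc j)
    n∸j≤1+n∸[1+j] zero    zero    = z≤n
    n∸j≤1+n∸[1+j] zero    (suc j) = z≤n
    n∸j≤1+n∸[1+j] (suc n) zero    = ≤-refl
    n∸j≤1+n∸[1+j] (suc n) (suc j) = n∸j≤1+n∸[1+j] n j

module Binomials where

  open import Data.Nat
  open import Data.Nat.Combinatorics using (_C_; nCk+nC[k+1]≡[n+1]C[k+1]; nC1≡n; k>n⇒nCk≡0)
  open import Data.Nat.Properties
  open import Data.Nat.Tactic.RingSolver using (solve-∀)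
  open import Relation.Binary.PropositionalEquality
  open import Relation.Nullary using (yes; no)

  k≤n⇒nCk>0 : ∀ {n k} → k ≤ n → n C k > 0
  k≤n⇒nCk>0 {n}     {zero}  _         = s≤s z≤n
  k≤n⇒nCk>0 {suc n} {suc k} (s≤s k≤n) =
    ≤-trans (k≤n⇒nCk>0 k≤n) (≤-trans (m≤m+n (n C k) _) (≤-reflexive (nCk+nC[k+1]≡[n+1]C[k+1] n k)))

  [1+k]*[1+n]C[1+k]≡[1+n]*nCk : ∀ n k → suc k * (suc n C suc k) ≡ suc n * (n C k)
  [1+k]*[1+n]C[1+k]≡[1+n]*nCk zero    zero    = refl
  [1+k]*[1+n]C[1+k]≡[1+n]*nCk zero    (suc k) = *-zeroʳ (suc (suc k))
  [1+k]*[1+n]C[1+k]≡[1+n]*nCk (suc n) zero    =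
    trans (*-identityˡ _) (trans (nC1≡n (suc (suc n))) (sym (*-identityʳ _)))
  [1+k]*[1+n]C[1+k]≡[1+n]*nCk (suc n) (suc k) = begin
    suc (suc k) * (suc (suc n) C suc (suc k))
      ≡⟨ cong (suc (suc k) *_) (nCk+nC[k+1]≡[n+1]C[k+1] (suc n) (suc k)) ⟨
    suc (suc k) * (a + b)
      ≡⟨ split a b k ⟩
    a + suc k * a + suc (suc k) * b              ≡⟨ cong₂ (λ x y → a + x + y) ([1+k]*[1+n]C[1+k]≡[1+n]*nCk n k)
                                                                          ([1+k]*[1+n]C[1+k]≡[1+n]*nCk n (suc k)) ⟩
    a + suc n * (n C k) + suc n * (n C suc k)    ≡⟨ +-assoc a _ _ ⟩
    a + (suc n * (n C k) + suc n * (n C suc k))  ≡⟨ cong (a +_) (*-distribˡ-+ (suc n) (n C k) (n C suc k)) ⟨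
    a + suc n * (n C k + n C suc k)              ≡⟨ cong (λ x → a + suc n * x) (nCk+nC[k+1]≡[n+1]C[k+1] n k) ⟩
    suc (suc n) * a                              ∎
    where
    open ≡-Reasoning
    a = suc n C suc k
    b = suc n C suc (suc k)
    split : ∀ a b k → suc (suc k) * (a + b) ≡ a + suc k * a + suc (suc k) * b
    split = solve-∀

  [1+k]*nC[1+k]+k*nCk≡n*nCk : ∀ n k → suc k * (n C suc k) + k * (n C k) ≡ n * (n C k)
  [1+k]*nC[1+k]+k*nCk≡n*nCk zero    zero    = refl
  [1+k]*nC[1+k]+k*nCk≡n*nCk zero    (suc k) = cong₂ _+_ (*-zeroʳ (suc (suc k))) (*-zeroʳ (suc k))
  [1+k]*nC[1+k]+k*nCk≡n*nCk (suc n) zero    =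
    trans (+-identityʳ _) (trans (*-identityˡ _) (trans (nC1≡n (suc n)) (sym (*-identityʳ _))))
  [1+k]*nC[1+k]+k*nCk≡n*nCk (suc n) (suc k) = begin
    suc (suc k) * (suc n C suc (suc k)) + suc k * (suc n C suc k)
      ≡⟨ cong₂ _+_ ([1+k]*[1+n]C[1+k]≡[1+n]*nCk n (suc k)) ([1+k]*[1+n]C[1+k]≡[1+n]*nCk n k) ⟩
    suc n * (n C suc k) + suc n * (n C k)
      ≡⟨ *-distribˡ-+ (suc n) (n C suc k) (n C k) ⟨
    suc n * (n C suc k + n C k)
      ≡⟨ cong (suc n *_) (trans (+-comm (n C suc k) (n C k)) (nCk+nC[k+1]≡[n+1]C[k+1] n k)) ⟩
    suc n * (suc n C suc k)
      ∎
    where open ≡-Reasoning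

  [1+k]*nC[1+k]≡[n∸k]*nCk : ∀ n k → suc k * (n C suc k) ≡ (n ∸ k) * (n C k)
  [1+k]*nC[1+k]≡[n∸k]*nCk n k =
    +-cancelʳ-≡ (k * (n C k)) _ _ (trans ([1+k]*nC[1+k]+k*nCk≡n*nCk n k) n*nCk-split)
    where
    n*nCk-split : n * (n C k) ≡ (n ∸ k) * (n C k) + k * (n C k)
    n*nCk-split with k ≤? n
    ... | yes k≤n = trans (cong (_* (n C k)) (sym (m∸n+n≡m k≤n))) (*-distribʳ-+ (n C k) (n ∸ k) k)
    ... | no  k≰n rewrite k>n⇒nCk≡0 (≰⇒> k≰n) | *-zeroʳ n | *-zeroʳ (n ∸ k) | *-zeroʳ k = refl

module Forests where

  open import Data.Bool using (Bool; true; false; _∧_; if_then_else_)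
  open import Data.Bool.Properties using (if-eta; ¬-not) renaming (_≟_ to _≟ᵇ_)
  open import Data.Empty using (⊥-elim)
  open import Data.Fin using (Fin; zero; suc; _<?_)
  open import Data.Fin.Properties using (_≟_; any?; injective⇒≤)
  open import Data.List using (List; []; _∷_; _++_; [_]; length; lookup)
  open import Data.List.Membership.Propositional.Properties using (∈-∃++; ∈-lookup)
  open import Data.List.Relation.Unary.All as All using (All; []; _∷_)
  open import Data.List.Relation.Unary.All.Properties using (¬Any⇒All¬; ++⁺; ++⁻ˡ; ++⁻ʳ)
  open import Data.List.Relation.Unary.AllPairs using (AllPairs; []; _∷_)
  import Data.List.Relation.Unary.Any as Any
  open import Data.List.Relation.Unary.Linked using (Linked; []; [-]; _∷_)
  open import Data.List.Relation.Unary.Unique.Propositional using (Unique)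
  open import Data.Nat hiding (_≟_; _<?_)
  open import Data.Nat.Properties hiding (_≟_; _<?_)
  open import Algebra.Properties.CommutativeMonoid.Sum +-0-commutativeMonoid using (sum-syntax; sum-cong-≗)
  open import Data.Product using (∃-syntax; _×_; _,_)
  open import Function using (_∘_)
  open import Relation.Binary.PropositionalEquality hiding ([_])
  open import Relation.Nullary using (¬_; yes; no; ¬?)
  open import Relation.Nullary.Decidable using (isYes; _×-dec_)
  open import Defs using (Graph; adj; irrefl; Adj; HasCycle)
  open Sums

  module _ {A : Set} where

    AllPairs-prefix : ∀ {R : A → A → Set} xs {y ys} → AllPairs R (xs ++ y ∷ ys) → AllPairs R (xs ++ [ y ])
    AllPairs-prefix []       _          = [] ∷ []
    AllPairs-prefix (x ∷ xs) (px ∷ pxs) with py ∷ _ ← ++⁻ʳ xs px =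
      ++⁺ (++⁻ˡ xs px) (py ∷ []) ∷ AllPairs-prefix xs pxs

    Linked-prefix : ∀ {R : A → A → Set} xs {y ys} → Linked R (xs ++ y ∷ ys) → Linked R (xs ++ [ y ])
    Linked-prefix []            _        = [-]
    Linked-prefix (x ∷ [])      (r ∷ _)  = r ∷ [-]
    Linked-prefix (x ∷ x′ ∷ xs) (r ∷ rs) = r ∷ Linked-prefix (x′ ∷ xs) rs

    Unique⇒lookup-injective : ∀ (xs : List A) → Unique xs → ∀ {i j} → lookup xs i ≡ lookup xs j → i ≡ j
    Unique⇒lookup-injective (x ∷ xs) (x∉ ∷ _)   {zero}  {zero}  _ = refl
    Unique⇒lookup-injective (x ∷ xs) (x∉ ∷ _)   {zero}  {suc j} e = ⊥-elim (All.lookup x∉ (∈-lookup j) e)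
    Unique⇒lookup-injective (x ∷ xs) (x∉ ∷ _)   {suc i} {zero}  e = ⊥-elim (All.lookup x∉ (∈-lookup i) (sym e))
    Unique⇒lookup-injective (x ∷ xs) (_ ∷ uniq) {suc i} {suc j} e = cong suc (Unique⇒lookup-injective xs uniq e)

  Unique⇒length≤ : ∀ {n} {xs : List (Fin n)} → Unique xs → length xs ≤ n
  Unique⇒length≤ {xs = xs} uniq = injective⇒≤ (Unique⇒lookup-injective xs uniq)

  module _ {n} (T : Graph n) where

    degree : (Fin n → Bool) → Fin n → ℕ
    degree U v = sumOver U (λ w → 𝟙 (adj T v w))

    arcs : (Fin n → Bool) → ℕ
    arcs U = sumOver U (degree U)

    edges : (Fin n → Bool) → ℕ
    edges U = ∑[ u < n ] ∑[ w < n ] (if isYes (u <? w) ∧ adj T u w then 𝟙 (U u ∧ U w) else 0)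

    degree-remove : ∀ U v u → U v ≡ true → degree U u ≡ 𝟙 (adj T u v) + degree (U ─ v) u
    degree-remove U v u = sumOver-remove U v (λ w → 𝟙 (adj T u w))

    arcs-remove : ∀ U v → U v ≡ true → arcs U ≡ 2 * degree (U ─ v) v + arcs (U ─ v)
    arcs-remove U v Uv = begin
      arcs U
        ≡⟨ sumOver-remove U v (degree U) Uv ⟩
      degree U v + sumOver R (degree U)
        ≡⟨ cong₂ _+_ (degree-remove U v v Uv) (sumOver-cong R λ u → degree-remove U v u Uv) ⟩
      (𝟙 (adj T v v) + degree R v) + sumOver R (λ u → 𝟙 (adj T u v) + degree R u)
        ≡⟨ cong₂ _+_ (cong (λ b → 𝟙 b + degree R v) (irrefl T v)) (sumOver-distrib-+ R _ (degree R)) ⟩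
      degree R v + (sumOver R (λ u → 𝟙 (adj T u v)) + arcs R)
        ≡⟨ cong (λ e → degree R v + (e + arcs R)) (sumOver-cong R λ u → cong 𝟙 (Graph.sym T u v)) ⟩
      degree R v + (degree R v + arcs R)
        ≡⟨ +-assoc (degree R v) _ _ ⟨
      degree R v + degree R v + arcs R
        ≡⟨ cong (λ e → degree R v + e + arcs R) (+-identityʳ (degree R v)) ⟨
      2 * degree R v + arcs R
        ∎
      where
      open ≡-Reasoning
      R = U ─ v

    arcs≡2*edges : ∀ U → arcs U ≡ 2 * edges U
    arcs≡2*edges U = begin
      arcs U
        ≡⟨ sum-cong-≗ (λ u → sum-if (U u) (λ w → if U w then 𝟙 (adj T u w) else 0)) ⟩
      ∑[ u < n ] ∑[ w < n ] g u w
        ≡⟨ ∑∑-symmetric g g-sym g-diag ⟩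
      2 * ∑[ u < n ] ∑[ w < n ] (if isYes (u <? w) then g u w else 0)
        ≡⟨ cong (2 *_) (sum-cong-≗ λ u → sum-cong-≗ λ w → edge-term u w) ⟩
      2 * edges U
        ∎
      where
      open ≡-Reasoning
      g : Fin n → Fin n → ℕ
      g u w = if U u then (if U w then 𝟙 (adj T u w) else 0) else 0
      g-sym : ∀ u w → g u w ≡ g w u
      g-sym u w with U u | U w
      ... | true  | true  = cong 𝟙 (Graph.sym T u w)
      ... | true  | false = refl
      ... | false | true  = refl
      ... | false | false = refl
      g-diag : ∀ u → g u u ≡ 0
      g-diag u with U u
      ... | true  = cong 𝟙 (irrefl T u)
      ... | false = refl
      if-𝟙-∧ : ∀ a b c → (if b then (if c then 𝟙 a else 0) else 0) ≡ (if a then 𝟙 (b ∧ c) else 0)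
      if-𝟙-∧ true  true  true  = refl
      if-𝟙-∧ true  true  false = refl
      if-𝟙-∧ true  false _     = refl
      if-𝟙-∧ false true  true  = refl
      if-𝟙-∧ false true  false = refl
      if-𝟙-∧ false false _     = refl
      edge-term : ∀ u w → (if isYes (u <? w) then g u w else 0)
                          ≡ (if isYes (u <? w) ∧ adj T u w then 𝟙 (U u ∧ U w) else 0)
      edge-term u w with isYes (u <? w)
      ... | true  = if-𝟙-∧ (adj T u w) (U u) (U w)
      ... | false = refl

    edges-remove : ∀ U v → U v ≡ true → edges U ≡ degree (U ─ v) v + edges (U ─ v)
    edges-remove U v Uv = *-cancelˡ-≡ _ _ 2 (begin
      2 * edges U                   ≡⟨ arcs≡2*edges U ⟨
      arcs U                        ≡⟨ arcs-remove U v Uv ⟩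
      2 * degree R v + arcs R       ≡⟨ cong (2 * degree R v +_) (arcs≡2*edges R) ⟩
      2 * degree R v + 2 * edges R  ≡⟨ *-distribˡ-+ 2 (degree R v) (edges R) ⟨
      2 * (degree R v + edges R)    ∎)
      where
      open ≡-Reasoning
      R = U ─ v

    edges-empty : ∀ U → (∀ x → U x ≡ false) → edges U ≡ 0
    edges-empty U U≡∅ = sum-zero λ u → sum-zero λ w → term u w
      where
      term : ∀ u w → (if isYes (u <? w) ∧ adj T u w then 𝟙 (U u ∧ U w) else 0) ≡ 0
      term u w rewrite U≡∅ u = if-eta (isYes (u <? w) ∧ adj T u w)

    degree≤size : ∀ U v → degree U v ≤ size U
    degree≤size U v = sumOver-mono-≤ U λ w → 𝟙≤1 (adj T v w)
      where
      𝟙≤1 : ∀ b → 𝟙 b ≤ 1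
      𝟙≤1 true  = ≤-refl
      𝟙≤1 false = z≤n

    another-neighbour : ∀ {U x} → 2 ≤ degree U x → ∀ y → ∃[ z ] ((U z ≡ true × Adj T x z) × ¬ z ≡ y)
    another-neighbour {U} {x} 2≤deg y
      with any? (λ z → ((U z ≟ᵇ true) ×-dec (adj T x z ≟ᵇ true)) ×-dec ¬? (z ≟ y))
    ... | yes found = found
    ... | no  none  = ⊥-elim (<⇒≱ 2≤deg (≤-trans (≤-reflexive (sum-single _ y only-y)) (term≤1 (U y))))
      where
      only-y : ∀ z → ¬ z ≡ y → (if U z then 𝟙 (adj T x z) else 0) ≡ 0
      only-y z z≢y with U z in Uz | adj T x z in xz
      ... | false | _     = refl
      ... | true  | false = refl
      ... | true  | true  = ⊥-elim (none (z , (Uz , xz) , z≢y))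
      term≤1 : ∀ b → (if b then 𝟙 (adj T x y) else 0) ≤ 1
      term≤1 false = z≤n
      term≤1 true with adj T x y
      ... | true  = ≤-refl
      ... | false = z≤n

    module _ {U : Fin n → Bool} (minDegree≥2 : ∀ v → U v ≡ true → 2 ≤ degree U v) where

      -- x ∷ y ∷ path is a path in U, newest vertex first. It is extended by a neighbour z ≠ y
      -- of x; if z is already on the path, a cycle closes. Uniqueness bounds the length by n.
      private
        grow : ∀ fuel x y path →
               Unique (x ∷ y ∷ path) → Linked (Adj T) (x ∷ y ∷ path) → All (λ v → U v ≡ true) (x ∷ y ∷ path) →
               n < fuel + length (x ∷ y ∷ path) → HasCycle T
        grow zero x y path uniq _ _ n<len = ⊥-elim (<⇒≱ n<len (Unique⇒length≤ uniq))
        grow (suc fuel) x y path uniq linked (Ux ∷ inU) n<len with another-neighbour (minDegree≥2 x Ux) y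
        ... | z , (Uz , xz) , z≢y with Any.any? (z ≟_) path
        ...   | yes z∈path with pre , post , refl ← ∈-∃++ {v = z} {xs = path} z∈path =
                x , z , y ∷ pre , s≤s z≤n , AllPairs-prefix (x ∷ y ∷ pre) uniq ,
                Linked-prefix (x ∷ y ∷ pre) linked , trans (Graph.sym T z x) xz
        ...   | no  z∉path =
                grow fuel z x (y ∷ path) ((z≢x ∷ z≢y ∷ ¬Any⇒All¬ path z∉path) ∷ uniq)
                     (trans (Graph.sym T z x) xz ∷ linked) (Uz ∷ Ux ∷ inU) (subst (n <_) (sym (+-suc fuel _)) n<len)
          where
          z≢x : ¬ z ≡ x
          z≢x refl with () ← trans (sym xz) (irrefl T z)

      minDegree≥2⇒cycle : ∀ {v} → U v ≡ true → HasCycle T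
      minDegree≥2⇒cycle {v} Uv with z , (Uz , vz) , z≢v ← another-neighbour (minDegree≥2 v Uv) v =
        grow n z v [] ((z≢v ∷ []) ∷ [] ∷ []) (trans (Graph.sym T z v) vz ∷ [-]) (Uz ∷ Uv ∷ []) (m<m+n n z<s)

    acyclic⇒edges≤size∸1 : ¬ HasCycle T → ∀ U → edges U ≤ size U ∸ 1
    acyclic⇒edges≤size∸1 acyclic U = go (size U) U ≤-refl
      where
      go : ∀ fuel U → size U ≤ fuel → edges U ≤ size U ∸ 1
      go fuel U _ with any? (λ v → (U v ≟ᵇ true) ×-dec (degree U v ≤? 1))
      go fuel U _ | no noLeaf with any? (λ v → U v ≟ᵇ true)
      ... | yes (v , Uv) = ⊥-elim (acyclic (minDegree≥2⇒cycle (λ w Uw → ≰⇒> λ d≤1 → noLeaf (w , Uw , d≤1)) Uv))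
      ... | no  U≢∅      = ≤-trans (≤-reflexive (edges-empty U λ x → ¬-not (U≢∅ ∘ (x ,_)))) z≤n
      go zero       U size≤0 | yes (v , Uv , _) with () ← subst (_≤ 0) (size-remove U v Uv) size≤0
      go (suc fuel) U size≤  | yes (v , Uv , d≤1) = begin
        edges U                ≡⟨ edges-remove U v Uv ⟩
        degree R v + edges R   ≤⟨ leaf+forest (subst (_≤ 1) deg-R d≤1) (degree≤size R v) (go fuel R size-R≤) ⟩
        size R                 ≡⟨ cong (_∸ 1) (size-remove U v Uv) ⟨
        size U ∸ 1             ∎
        where
        open ≤-Reasoning
        R = U ─ v
        size-R≤ : size R ≤ fuel
        size-R≤ = ≤-pred (subst (_≤ suc fuel) (size-remove U v Uv) size≤)
        deg-R : degree U v ≡ degree R v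
        deg-R = trans (degree-remove U v v Uv) (cong (λ b → 𝟙 b + degree R v) (irrefl T v))
        leaf+forest : ∀ {a b m} → a ≤ 1 → a ≤ m → b ≤ m ∸ 1 → a + b ≤ m
        leaf+forest {m = zero}  _   z≤n b≤0 = b≤0
        leaf+forest {m = suc m} a≤1 _   b≤m = +-mono-≤ a≤1 b≤m

module Domination where

  open import Data.Bool using (Bool; true; false; _∧_; _∨_; not; if_then_else_)
  open import Data.Bool.Properties using () renaming (_≟_ to _≟ᵇ_)
  open import Data.Empty using (⊥-elim)
  open import Data.Fin using (Fin; _<?_)
  open import Data.Fin.Properties using (_≟_; any?; ¬∀⟶∃¬)
  open import Data.Fin.Subset using (Subset; _∈_; _∪_; ∣_∣)
  open import Data.Fin.Subset.Properties using (_∈?_)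
  open import Data.Nat hiding (_≟_; _<?_)
  open import Data.Nat.Combinatorics using (_C_)
  open import Data.Nat.Properties hiding (_≟_; _<?_)
  open import Algebra.Properties.CommutativeMonoid.Sum +-0-commutativeMonoid using (sum-syntax; sum-cong-≗)
  open import Data.Nat.Tactic.RingSolver using (solve-∀)
  open import Data.Product using (∃-syntax; _,_)
  import Data.Product as Product
  open import Data.Sum using (inj₁; inj₂)
  import Data.Sum as Sum
  open import Function using (_∘_)
  open import Relation.Binary.PropositionalEquality
  open import Relation.Nullary using (¬_; Dec; yes; no; does)
  open import Relation.Nullary.Decidable using (isYes; _×-dec_; _⊎-dec_; dec-true)
  open import Defs using (Graph; adj; HasCycle; Dominating?; closedNbhd; d; UnimodalWithMode)
  open Sums
  open SubsetSums
  open Binomials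
  open Forests

  does≡true⇒ : ∀ {A : Set} (a? : Dec A) → does a? ≡ true → A
  does≡true⇒ (yes a) _ = a

  does≡false⇒¬ : ∀ {A : Set} (a? : Dec A) → does a? ≡ false → ¬ A
  does≡false⇒¬ (no ¬a) _ = ¬a

  -- With σ_k = A/D, τ_k = W/D, D = C(n,k) and C′ = C(n,k+1), this turns
  -- σ_k − τ_k ≤ (2k+1−n)/(k+1) into σ_k − τ_k ≤ 1 − C′/D.
  cleared-hypothesis⇒ : ∀ {A W D C′} k n → suc k * C′ + k * D ≡ n * D →
                        A * suc k + n * D ≤ W * suc k + (2 * k + 1) * D → A + C′ ≤ W + D
  cleared-hypothesis⇒ {A} {W} {D} {C′} k n identity hyp = *-cancelˡ-≤ (suc k) (+-cancelʳ-≤ (k * D) _ _ (begin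
    suc k * (A + C′) + k * D          ≡⟨ regroupˡ A C′ D k ⟩
    A * suc k + (suc k * C′ + k * D)  ≡⟨ cong (A * suc k +_) identity ⟩
    A * suc k + n * D                 ≤⟨ hyp ⟩
    W * suc k + (2 * k + 1) * D       ≡⟨ regroupʳ W D k ⟩
    suc k * (W + D) + k * D           ∎))
    where
    open ≤-Reasoning
    regroupˡ : ∀ A C′ D k → suc k * (A + C′) + k * D ≡ A * suc k + (suc k * C′ + k * D)
    regroupˡ = solve-∀
    regroupʳ : ∀ W D k → W * suc k + (2 * k + 1) * D ≡ suc k * (W + D) + k * D
    regroupʳ = solve-∀

  module _ {n} (G : Graph n) where

    dominating : Subset n → Bool
    dominating S = does (Dominating? G S)

    undominated : Subset n → Fin n → Bool
    undominated S v = disjoint S (closedNbhd G v)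

    vertexWeight : ℕ → ℕ
    vertexWeight k = ∑[ v < n ] ((n ∸ ∣ closedNbhd G v ∣) C k)

    edgeWeight : Graph n → ℕ → ℕ
    edgeWeight T k = ∑[ u < n ] ∑[ w < n ]
      (if isYes (u <? w) ∧ adj T u w then (n ∸ ∣ closedNbhd G u ∪ closedNbhd G w ∣) C k else 0)

    d≡count-dominating : ∀ j → d G j ≡ count n j dominating
    d≡count-dominating j = length-filter-allSubsets n j (Dominating? G)

    dominating-upClosed : UpClosed dominating
    dominating-upClosed {S} {S′} S⊆S′ domS = dec-true (Dominating? G S′)
      (Sum.map S⊆S′ (Product.map₂ (Product.map₁ S⊆S′)) ∘ does≡true⇒ (Dominating? G S) domS)

    nondominating⇒undominated : ∀ {S} → dominating S ≡ false → ∃[ v ] undominated S v ≡ true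
    nondominating⇒undominated {S} ¬domS
      with v , ¬domv ← ¬∀⟶∃¬ n _ (λ v → (v ∈? S) ⊎-dec any? (λ u → (u ∈? S) ×-dec (adj G u v ≟ᵇ true)))
                                 (does≡false⇒¬ (Dominating? G S) ¬domS)
      = v , disjoint-tabulate S _ outside-N[v]
      where
      outside-N[v] : ∀ u → u ∈ S → (isYes (u ≟ v) ∨ adj G v u) ≡ false
      outside-N[v] u u∈S with u ≟ v | adj G v u in vu
      ... | yes refl | _     = ⊥-elim (¬domv (inj₁ u∈S))
      ... | no  _    | true  = ⊥-elim (¬domv (inj₂ (u , u∈S , trans (Graph.sym G u v) vu)))
      ... | no  _    | false = refl

    subsetSum-size-undominated : ∀ k → subsetSum n k (λ S → size (undominated S)) ≡ vertexWeight k
    subsetSum-size-undominated k = trans (subsetSum-∑-comm n k λ S v → 𝟙 (undominated S v))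
                                         (sum-cong-≗ λ v → count-disjoint n k (closedNbhd G v))

    subsetSum-edges-undominated : ∀ T k → subsetSum n k (λ S → edges T (undominated S)) ≡ edgeWeight T k
    subsetSum-edges-undominated T k = begin
      subsetSum n k (λ S → ∑[ u < n ] ∑[ w < n ] term S u w)
        ≡⟨ subsetSum-∑-comm n k (λ S u → ∑[ w < n ] term S u w) ⟩
      ∑[ u < n ] subsetSum n k (λ S → ∑[ w < n ] term S u w)
        ≡⟨ sum-cong-≗ (λ u → subsetSum-∑-comm n k (λ S → term S u)) ⟩
      ∑[ u < n ] ∑[ w < n ] subsetSum n k (λ S → term S u w)
        ≡⟨ sum-cong-≗ (λ u → sum-cong-≗ λ w → subsetSum-term u w) ⟩
      edgeWeight T k
        ∎
      where
      open ≡-Reasoning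
      b : Fin n → Fin n → Bool
      b u w = isYes (u <? w) ∧ adj T u w
      term : Subset n → Fin n → Fin n → ℕ
      term S u w = if b u w then 𝟙 (undominated S u ∧ undominated S w) else 0
      subsetSum-term : ∀ u w → subsetSum n k (λ S → term S u w)
                               ≡ (if b u w then (n ∸ ∣ closedNbhd G u ∪ closedNbhd G w ∣) C k else 0)
      subsetSum-term u w = trans (subsetSum-if n k (b u w) _) (cong (if b u w then_else 0) (begin
        subsetSum n k (λ S → 𝟙 (undominated S u ∧ undominated S w))
          ≡⟨ subsetSum-cong n k (λ S → cong 𝟙 (disjoint-∪ S _ _)) ⟨
        count n k (λ S → disjoint S (closedNbhd G u ∪ closedNbhd G w))
          ≡⟨ count-disjoint n k _ ⟩
        (n ∸ ∣ closedNbhd G u ∪ closedNbhd G w ∣) C k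
          ∎))

    nondominating+edges≤size-undominated : ∀ {T} → ¬ HasCycle T → ∀ S →
      𝟙 (not (dominating S)) + edges T (undominated S) ≤ size (undominated S)
    nondominating+edges≤size-undominated {T} acyclic S with dominating S in domS
    ... | true  = ≤-trans (acyclic⇒edges≤size∸1 T acyclic (undominated S)) (m∸n≤m (size (undominated S)) 1)
    ... | false with v , Uv ← nondominating⇒undominated domS = begin
      1 + edges T U       ≤⟨ s≤s (acyclic⇒edges≤size∸1 T acyclic U) ⟩
      suc (size U ∸ 1)    ≡⟨ cong (λ s → suc (s ∸ 1)) (size-remove U v Uv) ⟩
      suc (size (U ─ v))  ≡⟨ size-remove U v Uv ⟨
      size U              ∎
      where
      open ≤-Reasoning
      U = undominated S

    nondominating+edgeWeight≤vertexWeight : ∀ {T} → ¬ HasCycle T → ∀ k →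
      count n k (not ∘ dominating) + edgeWeight T k ≤ vertexWeight k
    nondominating+edgeWeight≤vertexWeight {T} acyclic k = begin
      count n k (not ∘ dominating) + edgeWeight T k
        ≡⟨ cong (count n k (not ∘ dominating) +_) (subsetSum-edges-undominated T k) ⟨
      count n k (not ∘ dominating) + subsetSum n k (λ S → edges T (undominated S))
        ≡⟨ subsetSum-distrib-+ n k (𝟙 ∘ not ∘ dominating) _ ⟨
      subsetSum n k (λ S → 𝟙 (not (dominating S)) + edges T (undominated S))
        ≤⟨ subsetSum-mono-≤ n k (nondominating+edges≤size-undominated {T} acyclic) ⟩
      subsetSum n k (λ S → size (undominated S))
        ≡⟨ subsetSum-size-undominated k ⟩
      vertexWeight k
        ∎
      where open ≤-Reasoning

    d+nondominating≡C : ∀ j → d G j + count n j (not ∘ dominating) ≡ n C j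
    d+nondominating≡C j =
      trans (cong (_+ count n j (not ∘ dominating)) (d≡count-dominating j)) (count-complement n j dominating)

    d≤C : ∀ j → d G j ≤ n C j
    d≤C j = subst (d G j ≤_) (d+nondominating≡C j) (m≤m+n (d G j) _)

    d-LYM : ∀ j → d G j * (n ∸ j) ≤ d G (suc j) * suc j
    d-LYM j = subst₂ (λ x y → x * (n ∸ j) ≤ y * suc j) (sym (d≡count-dominating j)) (sym (d≡count-dominating (suc j)))
                     (count-upClosed-LYM n j dominating-upClosed)

    d-increasing : ∀ {j} → suc j ≤ n ∸ j → d G j ≤ d G (suc j)
    d-increasing {j} 1+j≤n∸j =
      *-cancelʳ-≤ (d G j) (d G (suc j)) (suc j) (≤-trans (*-monoʳ-≤ (d G j) 1+j≤n∸j) (d-LYM j))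

    C≤d-step : ∀ {j} → n C suc j ≤ d G j → n C suc (suc j) ≤ d G (suc j)
    C≤d-step {j} C≤d = *-cancelˡ-≤ (suc j) (begin
      suc j * (n C suc (suc j))        ≤⟨ *-monoˡ-≤ (n C suc (suc j)) (n≤1+n (suc j)) ⟩
      suc (suc j) * (n C suc (suc j))  ≡⟨ [1+k]*nC[1+k]≡[n∸k]*nCk n (suc j) ⟩
      (n ∸ suc j) * (n C suc j)        ≤⟨ *-monoˡ-≤ (n C suc j) (∸-monoʳ-≤ n (n≤1+n j)) ⟩
      (n ∸ j) * (n C suc j)            ≤⟨ *-monoʳ-≤ (n ∸ j) C≤d ⟩
      (n ∸ j) * d G j                  ≡⟨ *-comm (n ∸ j) (d G j) ⟩
      d G j * (n ∸ j)                  ≤⟨ d-LYM j ⟩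
      d G (suc j) * suc j              ≡⟨ *-comm (d G (suc j)) (suc j) ⟩
      suc j * d G (suc j)              ∎)
      where open ≤-Reasoning

    C≤d-above : ∀ {k} → n C suc k ≤ d G k → ∀ i → k ≤ i → n C suc i ≤ d G i
    C≤d-above {k} C≤d i k≤i = subst (λ i → n C suc i ≤ d G i) (m∸n+n≡m k≤i) (go (i ∸ k))
      where
      go : ∀ j → n C suc (j + k) ≤ d G (j + k)
      go zero    = C≤d
      go (suc j) = C≤d-step (go j)

    C[n,1+k]≤d : ∀ {T} → ¬ HasCycle T → ∀ k →
      vertexWeight k * suc k + n * (n C k) ≤ edgeWeight T k * suc k + (2 * k + 1) * (n C k) → n C suc k ≤ d G k
    C[n,1+k]≤d {T} acyclic k hyp = +-cancelʳ-≤ (a + W) _ _ (begin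
      n C suc k + (a + W)  ≤⟨ +-monoʳ-≤ (n C suc k) (nondominating+edgeWeight≤vertexWeight {T} acyclic k) ⟩
      n C suc k + A        ≡⟨ +-comm (n C suc k) A ⟩
      A + n C suc k        ≤⟨ cleared-hypothesis⇒ k n ([1+k]*nC[1+k]+k*nCk≡n*nCk n k) hyp ⟩
      W + n C k            ≡⟨ cong (W +_) (d+nondominating≡C k) ⟨
      W + (d G k + a)      ≡⟨ rearrange W (d G k) a ⟩
      d G k + (a + W)      ∎)
      where
      open ≤-Reasoning
      a = count n k (not ∘ dominating)
      A = vertexWeight k
      W = edgeWeight T k
      rearrange : ∀ W d a → W + (d + a) ≡ d + (a + W)
      rearrange = solve-∀

    unimodal : ∀ k → k + k ≤ suc n → n C suc k ≤ d G k → UnimodalWithMode G k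
    unimodal k 2k≤1+n C≤d = increasing , decreasing
      where
      increasing : ∀ i → i < k → d G i ≤ d G (suc i)
      increasing i i<k = d-increasing (m+n≤o⇒m≤o∸n (suc i) (≤-pred (begin
        suc (suc i + i)  ≡⟨ +-suc (suc i) i ⟨
        suc i + suc i    ≤⟨ +-mono-≤ i<k i<k ⟩
        k + k            ≤⟨ 2k≤1+n ⟩
        suc n            ∎)))
        where open ≤-Reasoning
      decreasing : ∀ i → k ≤ i → i < n → d G (suc i) ≤ d G i
      decreasing i k≤i _ = ≤-trans (d≤C (suc i)) (C≤d-above C≤d i k≤i)

  ⌈n/2⌉+⌈n/2⌉≤1+n : ∀ n → ⌈ n /2⌉ + ⌈ n /2⌉ ≤ suc n
  ⌈n/2⌉+⌈n/2⌉≤1+n n =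
    ≤-trans (+-monoʳ-≤ ⌈ n /2⌉ (⌊n/2⌋≤⌈n/2⌉ (suc n))) (≤-reflexive (⌊n/2⌋+⌈n/2⌉≡n (suc n)))

module Fractions where

  open import Data.Bool using (true; false; _∧_; if_then_else_)
  open import Data.Fin using (Fin; zero; suc; _<?_)
  open import Data.Fin.Subset using (∣_∣; _∪_)
  open import Data.Integer as ℤ using (+_)
  import Data.Integer.Properties as ℤ
  open import Data.Integer.Tactic.RingSolver using (solve-∀)
  open import Data.List using (tabulate)
  open import Data.Nat hiding (_<?_)
  open import Data.Nat.Properties using (+-0-commutativeMonoid; +-comm; suc-pred)
  open import Algebra.Properties.CommutativeMonoid.Sum +-0-commutativeMonoid using (sum-syntax)
  open import Data.Nat.Combinatorics using (_C_)
  open import Data.Rational as ℚ using (ℚ; 0ℚ; toℚᵘ)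
  import Data.Rational.Properties as ℚ
  open import Data.Rational.Unnormalised as ℚᵘ using (mkℚᵘ; *≡*; *≤*; _≃_)
  import Data.Rational.Unnormalised.Properties as ℚᵘ
  open import Function using (id)
  open import Relation.Binary.PropositionalEquality
  open import Relation.Nullary.Decidable using (isYes)
  open import Defs using (Graph; adj; closedNbhd; frac; Σℚ; σ; treeWeight)
  open Binomials using (k≤n⇒nCk>0)
  open Domination using (vertexWeight; edgeWeight)

  toℚᵘ-frac : ∀ a {D m} → D ≡ suc m → toℚᵘ (frac a D) ≃ mkℚᵘ (+ a) m
  toℚᵘ-frac a {m = m} refl = ℚ.toℚᵘ-fromℚᵘ (mkℚᵘ (+ a) m)

  mkℚᵘ-+ : ∀ a b m → mkℚᵘ (+ a) m ℚᵘ.+ mkℚᵘ (+ b) m ≃ mkℚᵘ (+ (a + b)) m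
  mkℚᵘ-+ a b m = *≡* (begin
    (+ a ℤ.* + M ℤ.+ + b ℤ.* + M) ℤ.* + M  ≡⟨ factor (+ a) (+ b) (+ M) ⟩
    (+ a ℤ.+ + b) ℤ.* (+ M ℤ.* + M)        ≡⟨ cong₂ ℤ._*_ (ℤ.pos-+ a b) (ℤ.pos-* M M) ⟨
    + (a + b) ℤ.* + (M * M)                ∎)
    where
    open ≡-Reasoning
    M = suc m
    factor : ∀ a b d → (a ℤ.* d ℤ.+ b ℤ.* d) ℤ.* d ≡ (a ℤ.+ b) ℤ.* (d ℤ.* d)
    factor = solve-∀

  toℚᵘ-Σℚ : ∀ {A : Set} {N} m (h : Fin N → A) {f : A → ℚ} {g : A → ℕ} →
            (∀ x → toℚᵘ (f x) ≃ mkℚᵘ (+ g x) m) → toℚᵘ (Σℚ (tabulate h) f) ≃ mkℚᵘ (+ ∑[ i < N ] g (h i)) m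
  toℚᵘ-Σℚ {N = zero}  m h f≃g = *≡* refl
  toℚᵘ-Σℚ {N = suc N} m h {f} {g} f≃g = ℚᵘ.≃-trans (ℚ.toℚᵘ-homo-+ (f (h zero)) _)
    (ℚᵘ.≃-trans (ℚᵘ.+-cong (f≃g (h zero)) (toℚᵘ-Σℚ m (λ i → h (suc i)) f≃g))
                (mkℚᵘ-+ (g (h zero)) (∑[ i < N ] g (h (suc i))) m))

  mkℚᵘ-differences-≤ : ∀ a b c e m l →
    mkℚᵘ (+ a) m ℚᵘ.- mkℚᵘ (+ b) m ℚᵘ.≤ mkℚᵘ (+ c) l ℚᵘ.- mkℚᵘ (+ e) l →
    a * suc l + e * suc m ≤ b * suc l + c * suc m
  mkℚᵘ-differences-≤ a b c e m l (*≤* z) =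
    ℤ.drop‿+≤+ (subst₂ ℤ._≤_ (sym (cast a e)) (sym (cast b c)) (ℤ.*-cancelʳ-≤-pos _ _ (+ M ℤ.* + L) cleared))
    where
    M = suc m
    L = suc l
    cast : ∀ x y → + (x * L + y * M) ≡ + x ℤ.* + L ℤ.+ + y ℤ.* + M
    cast x y = trans (ℤ.pos-+ (x * L) (y * M)) (cong₂ ℤ._+_ (ℤ.pos-* x L) (ℤ.pos-* y M))
    z′ : (+ a ℤ.* + M ℤ.+ ℤ.- + b ℤ.* + M) ℤ.* (+ L ℤ.* + L) ℤ.≤ (+ c ℤ.* + L ℤ.+ ℤ.- + e ℤ.* + L) ℤ.* (+ M ℤ.* + M)
    z′ = subst₂ ℤ._≤_ (cong ((+ a ℤ.* + M ℤ.+ ℤ.- + b ℤ.* + M) ℤ.*_) (ℤ.pos-* L L))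
                      (cong ((+ c ℤ.* + L ℤ.+ ℤ.- + e ℤ.* + L) ℤ.*_) (ℤ.pos-* M M)) z
    left : ∀ a b e M L → (a ℤ.* M ℤ.+ ℤ.- b ℤ.* M) ℤ.* (L ℤ.* L) ℤ.+ (b ℤ.* M ℤ.* (L ℤ.* L) ℤ.+ e ℤ.* L ℤ.* (M ℤ.* M))
                         ≡ (a ℤ.* L ℤ.+ e ℤ.* M) ℤ.* (M ℤ.* L)
    left = solve-∀
    right : ∀ b c e M L → (c ℤ.* L ℤ.+ ℤ.- e ℤ.* L) ℤ.* (M ℤ.* M) ℤ.+ (b ℤ.* M ℤ.* (L ℤ.* L) ℤ.+ e ℤ.* L ℤ.* (M ℤ.* M))
                          ≡ (b ℤ.* L ℤ.+ c ℤ.* M) ℤ.* (M ℤ.* L)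
    right = solve-∀
    cleared : (+ a ℤ.* + L ℤ.+ + e ℤ.* + M) ℤ.* (+ M ℤ.* + L) ℤ.≤ (+ b ℤ.* + L ℤ.+ + c ℤ.* + M) ℤ.* (+ M ℤ.* + L)
    cleared = subst₂ ℤ._≤_ (left (+ a) (+ b) (+ e) (+ M) (+ L)) (right (+ b) (+ c) (+ e) (+ M) (+ L))
                     (ℤ.+-monoˡ-≤ (+ b ℤ.* + M ℤ.* (+ L ℤ.* + L) ℤ.+ + e ℤ.* + L ℤ.* (+ M ℤ.* + M)) z′)

  differences-≤ : ∀ {p q r s : ℚ} {a b c e m l} →
    toℚᵘ p ≃ mkℚᵘ (+ a) m → toℚᵘ q ≃ mkℚᵘ (+ b) m → toℚᵘ r ≃ mkℚᵘ (+ c) l → toℚᵘ s ≃ mkℚᵘ (+ e) l →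
    p ℚ.- q ℚ.≤ r ℚ.- s → a * suc l + e * suc m ≤ b * suc l + c * suc m
  differences-≤ {p} {q} {r} {s} {a} {b} {c} {e} {m} {l} p≃ q≃ r≃ s≃ p-q≤r-s =
    mkℚᵘ-differences-≤ a b c e m l
      (ℚᵘ.≤-respʳ-≃ (difference r s r≃ s≃) (ℚᵘ.≤-respˡ-≃ (difference p q p≃ q≃) (ℚ.toℚᵘ-mono-≤ p-q≤r-s)))
    where
    difference : ∀ x y {X Y} → toℚᵘ x ≃ X → toℚᵘ y ≃ Y → toℚᵘ (x ℚ.- y) ≃ X ℚᵘ.- Y
    difference x y x≃ y≃ = ℚᵘ.≃-trans (ℚ.toℚᵘ-homo-+ x (ℚ.- y))
                                      (ℚᵘ.+-cong x≃ (ℚᵘ.≃-trans (ℚ.toℚᵘ-homo‿- y) (ℚᵘ.-‿cong y≃)))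

  module _ {n} (G : Graph n) where

    toℚᵘ-σ : ∀ k {m} → n C k ≡ suc m → toℚᵘ (σ k G) ≃ mkℚᵘ (+ vertexWeight G k) m
    toℚᵘ-σ k {m} nCk≡1+m =
      toℚᵘ-Σℚ m id {g = λ v → (n ∸ ∣ closedNbhd G v ∣) C k} (λ v → toℚᵘ-frac _ nCk≡1+m)

    toℚᵘ-treeWeight : ∀ T k {m} → n C k ≡ suc m → toℚᵘ (treeWeight k G T) ≃ mkℚᵘ (+ edgeWeight G T k) m
    toℚᵘ-treeWeight T k {m} nCk≡1+m =
      toℚᵘ-Σℚ m id {g = λ u → ∑[ w < n ] weight u w} (λ u → toℚᵘ-Σℚ m id {g = weight u} (term u))
      where
      weight : Fin n → Fin n → ℕ
      weight u w = if isYes (u <? w) ∧ adj T u w then (n ∸ ∣ closedNbhd G u ∪ closedNbhd G w ∣) C k else 0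
      term : ∀ u w → toℚᵘ (if isYes (u <? w) ∧ adj T u w
                             then frac ((n ∸ ∣ closedNbhd G u ∪ closedNbhd G w ∣) C k) (n C k) else 0ℚ)
                     ≃ mkℚᵘ (+ weight u w) m
      term u w with isYes (u <? w) ∧ adj T u w
      ... | true  = toℚᵘ-frac _ nCk≡1+m
      ... | false = *≡* refl

    hypothesis-cleared : ∀ T k → k ≤ n →
      σ k G ℚ.- treeWeight k G T ℚ.≤ frac (2 * k + 1) (k + 1) ℚ.- frac n (k + 1) →
      vertexWeight G k * suc k + n * (n C k) ≤ edgeWeight G T k * suc k + (2 * k + 1) * (n C k)
    hypothesis-cleared T k k≤n hyp =
      subst (λ D → vertexWeight G k * suc k + n * D ≤ edgeWeight G T k * suc k + (2 * k + 1) * D)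
            (sym nCk≡1+m)
            (differences-≤ (toℚᵘ-σ k nCk≡1+m) (toℚᵘ-treeWeight T k nCk≡1+m)
                           (toℚᵘ-frac _ (+-comm k 1)) (toℚᵘ-frac n (+-comm k 1)) hyp)
      where
      m = pred (n C k)
      nCk≡1+m : n C k ≡ suc m
      nCk≡1+m = sym (suc-pred (n C k) {{>-nonZero (k≤n⇒nCk>0 k≤n)}})

-- The statement uses ℚ's _-_ and _≤_ unqualified, which would clash with ℕ's inside the modules above.
open import Defs
open import Data.Nat using (ℕ; _+_; _*_; ⌈_/2⌉)
open import Data.Rational using (ℚ; _-_; _≤_)
open import Data.Product using (Σ; _×_; _,_)
open import Data.Nat.Properties using (⌈n/2⌉≤n)
open import Relation.Binary.PropositionalEquality using (refl)
open Domination using (unimodal; C[n,1+k]≤d; ⌈n/2⌉+⌈n/2⌉≤1+n)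
open Fractions using (hypothesis-cleared)

theorem15 : (n : ℕ) (G : Graph n) →
    (Σ ℚ λ τk → IsTau ⌈ n /2⌉ G τk ×
      (σ ⌈ n /2⌉ G - τk ≤ frac (2 * ⌈ n /2⌉ + 1) (⌈ n /2⌉ + 1) - frac n (⌈ n /2⌉ + 1))) →
    UnimodalWithMode G ⌈ n /2⌉
theorem15 n G (_ , ((T , (_ , acyclic) , refl) , _) , hyp) =
  unimodal G k (⌈n/2⌉+⌈n/2⌉≤1+n n) (C[n,1+k]≤d G {T} acyclic k (hypothesis-cleared G T k (⌈n/2⌉≤n n) hyp))
  where
  k = ⌈ n /2⌉
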